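{- Let $p$ and $k$ be integers with $p\geq k+2$ and $k\geq 3$. Let $G_{p,k}$ be the graph obtained from the complete graph $K_p$ by adding, for every $k$-element subset $S$ of $V(K_p)$, a new vertex $x_S$ together with the edges $x_Su$ for all $u\in S$. Then $\gamma_{t[1,2]}(G_{p,k})=+\infty$, i.e. $G_{p,k}$ has no total $[1,2]$-set.
   Context: All graphs are finite, simple and undirected; $N(v)$ denotes the neighborhood of $v$. A set $S\subseteq V(G)$ is a total $[1,2]$-set of $G$ if $1\leq |N(v)\cap S|\leq 2$ for every vertex $v\in V(G)$. $\gamma_{t[1,2]}(G)$ is the minimum cardinality of a total $[1,2]$-set of $G$, with $\gamma_{t[1,2]}(G)=+\infty$ if no such set exists. -}

module Defs where

open import Data.Nat using (ℕ; zero; suc; _≤_; _≟_)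
open import Data.Bool using (Bool; true; false; _∧_; not)
open import Data.Fin using (Fin)
open import Data.Fin.Subset using (Subset; ∣_∣; _∈_)
open import Data.Fin.Subset.Properties using (_∈?_)
open import Data.Fin.Properties renaming (_≟_ to _≟ᶠ_)
open import Data.List using (List; []; _∷_; _++_; map; filter; allFin; length)
open import Data.List.Membership.Propositional renaming (_∈_ to _∈ˡ_)
open import Data.Vec using (Vec; []; _∷_)
open import Data.Sum using (_⊎_; inj₁; inj₂)
open import Data.Product using (Σ; _×_)
open import Relation.Nullary.Decidable using (⌊_⌋)

-- A finite simple graph, presented by a vertex type, an explicit duplicate-free
-- list of its vertices V(G), and a Boolean adjacency relation
-- (symmetric and irreflexive on V(G)).
record Graph : Set₁ where
  field
    Vtx      : Set
    vertices : List Vtx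
    adj      : Vtx → Vtx → Bool

open Graph public

countNbrIn : (G : Graph) → (Vtx G → Bool) → Vtx G → ℕ
countNbrIn G S v = length (filter (λ u → Data.Bool._≟_ (adj G v u ∧ S u) true) (vertices G))

IsTotal12Set : (G : Graph) → (Vtx G → Bool) → Set
IsTotal12Set G S = ∀ v → v ∈ˡ vertices G → 1 ≤ countNbrIn G S v × countNbrIn G S v ≤ 2

NoTotal12Set : Graph → Set
NoTotal12Set G = Σ (Vtx G → Bool) (IsTotal12Set G) → Data.Empty.⊥
  where import Data.Empty

allSubsets : (n : ℕ) → List (Subset n)
allSubsets zero    = [] ∷ []
allSubsets (suc n) = map (true ∷_) (allSubsets n) ++ map (false ∷_) (allSubsets n)

kSubsets : (p k : ℕ) → List (Subset p)
kSubsets p k = filter (λ S → ∣ S ∣ ≟ k) (allSubsets p)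

-- G_{p,k}: vertices inj₁ u (u ∈ V(K_p) = Fin p) and inj₂ S (the new vertex x_S,
-- for S a k-element subset of Fin p).  Edges: uv for u ≠ v in K_p, and x_S u for u ∈ S.
Gpk : ℕ → ℕ → Graph
Gpk p k = record
  { Vtx      = Fin p ⊎ Subset p
  ; vertices = map inj₁ (allFin p) ++ map inj₂ (kSubsets p k)
  ; adj      = a
  }
  where
  a : Fin p ⊎ Subset p → Fin p ⊎ Subset p → Bool
  a (inj₁ u) (inj₁ v) = not ⌊ u ≟ᶠ v ⌋
  a (inj₁ u) (inj₂ S) = ⌊ u ∈? S ⌋
  a (inj₂ S) (inj₁ u) = ⌊ u ∈? S ⌋
  a (inj₂ S) (inj₂ T) = false

-- Let T be the trace of S on the clique K_p and t = |T|.  The vertex x_A sees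
-- exactly |A ∩ T| vertices of S, and as A ranges over the k-subsets of V(K_p),
-- |A ∩ T| takes every value a with a ≤ t and k − a ≤ p − t.  If t ≤ 2 then,
-- since p − t ≥ k, some x_A sees no vertex of S; otherwise some x_A sees
-- min(t, k) ≥ 3 of them.
module Submission where

open import Defs
open import Data.Nat using (ℕ; zero; suc; _+_; _∸_; _≤_; _≤?_; z≤n; s≤s) renaming (_≟_ to _≟ⁿ_)
open import Data.Nat.Properties
  using ( +-suc; +-identityʳ; +-monoʳ-≤; ≤-refl; ≤-reflexive; ≤-trans; ≤-total
        ; m≤m+n; m+n≤o⇒m≤o∸n; m∸n+n≡m; m+[n∸m]≡n; <⇒≱; 1+n≰n )
open import Data.Bool using (Bool; true; false; _∧_)
open import Data.Bool.Properties using () renaming (_≟_ to _≟ᵇ_)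
open import Data.Fin using (Fin)
import Data.Fin as Fin
open import Data.Fin.Subset using (Subset; ∣_∣; ∁; _∩_)
open import Data.Fin.Subset.Properties using (_∈?_; ∣∁p∣≡n∸∣p∣)
open import Data.List using ([]; _∷_; _++_; map; filter; allFin; length)
import Data.List as List
open import Data.List.Properties using (filter-++; filter-none; ++-identityʳ; map-tabulate)
open import Data.List.Relation.Unary.Any using (here)
import Data.List.Relation.Unary.All as All
import Data.List.Relation.Unary.All.Properties as All
open import Data.List.Membership.Propositional renaming (_∈_ to _∈ˡ_)
open import Data.List.Membership.Propositional.Properties using (∈-++⁺ˡ; ∈-++⁺ʳ; ∈-map⁺; ∈-filter⁺)
open import Data.Vec using ([]; _∷_; lookup; tabulate)
open import Data.Vec.Properties using (tabulate-cong)
open import Data.Sum using (_⊎_; inj₁; inj₂)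
open import Data.Product using (Σ; _×_; _,_; proj₁; proj₂)
open import Data.Empty using (⊥)
open import Relation.Nullary using (Dec; yes; no)
open import Relation.Nullary.Decidable using (⌊_⌋)
open import Relation.Binary.PropositionalEquality using (_≡_; refl; sym; trans; cong; subst; module ≡-Reasoning)
open import Function using (_∘_; id)

∃-subset-meeting : ∀ {n} (T : Subset n) (a c : ℕ) → a ≤ ∣ T ∣ → c ≤ ∣ ∁ T ∣ →
                   Σ (Subset n) λ A → ∣ A ∣ ≡ a + c × ∣ A ∩ T ∣ ≡ a
∃-subset-meeting []          zero    zero    _         _ = [] , refl , refl
∃-subset-meeting (true ∷ T)  (suc a) c       (s≤s a≤t) c≤t̄
  with A , ∣A∣ , ∣A∩T∣ ← ∃-subset-meeting T a c a≤t c≤t̄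
  = true ∷ A , cong suc ∣A∣ , cong suc ∣A∩T∣
∃-subset-meeting (true ∷ T)  zero    c       _         c≤t̄
  with A , ∣A∣ , ∣A∩T∣ ← ∃-subset-meeting T zero c z≤n c≤t̄
  = false ∷ A , ∣A∣ , ∣A∩T∣
∃-subset-meeting (false ∷ T) a       (suc c) a≤t       (s≤s c≤t̄)
  with A , ∣A∣ , ∣A∩T∣ ← ∃-subset-meeting T a c a≤t c≤t̄
  = true ∷ A , trans (cong suc ∣A∣) (sym (+-suc a c)) , ∣A∩T∣
∃-subset-meeting (false ∷ T) a       zero    a≤t       _
  with A , ∣A∣ , ∣A∩T∣ ← ∃-subset-meeting T a zero a≤t z≤n
  = false ∷ A , ∣A∣ , ∣A∩T∣

m+∣p∣≤n⇒m≤∣∁p∣ : ∀ {n m} (T : Subset n) → m + ∣ T ∣ ≤ n → m ≤ ∣ ∁ T ∣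
m+∣p∣≤n⇒m≤∣∁p∣ {m = m} T m+t≤n = subst (m ≤_) (sym (∣∁p∣≡n∸∣p∣ T)) (m+n≤o⇒m≤o∸n m m+t≤n)

∈-allSubsets : ∀ {n} (A : Subset n) → A ∈ˡ allSubsets n
∈-allSubsets []      = here refl
∈-allSubsets {suc n} (true ∷ A)  = ∈-++⁺ˡ (∈-map⁺ (true ∷_) (∈-allSubsets A))
∈-allSubsets {suc n} (false ∷ A) =
  ∈-++⁺ʳ (map (true ∷_) (allSubsets n)) (∈-map⁺ (false ∷_) (∈-allSubsets A))

⌊∈?⌋≡lookup : ∀ {n} (x : Fin n) (A : Subset n) → ⌊ x ∈? A ⌋ ≡ lookup A x
⌊∈?⌋≡lookup Fin.zero    (true ∷ A)  = refl
⌊∈?⌋≡lookup Fin.zero    (false ∷ A) = refl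
⌊∈?⌋≡lookup (Fin.suc x) (_ ∷ A) with x ∈? A | ⌊∈?⌋≡lookup x A
... | yes _ | eq = eq
... | no _  | eq = eq

tabulate-lookup-∧ : ∀ {n} (A : Subset n) (g : Fin n → Bool) →
                    tabulate (λ u → lookup A u ∧ g u) ≡ A ∩ tabulate g
tabulate-lookup-∧ []      g = refl
tabulate-lookup-∧ (a ∷ A) g = cong (a ∧ g Fin.zero ∷_) (tabulate-lookup-∧ A (g ∘ Fin.suc))

length-filter-tabulate : ∀ {n} {Y : Set} (b : Y → Bool) (h : Fin n → Y) →
  length (filter (λ y → b y ≟ᵇ true) (List.tabulate h)) ≡ ∣ tabulate (b ∘ h) ∣
length-filter-tabulate {zero}  b h = refl
length-filter-tabulate {suc n} b h
  with b (h Fin.zero) | length-filter-tabulate b (h ∘ Fin.suc)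
... | true  | ih = cong suc ih
... | false | ih = ih

cliqueTrace : ∀ {p} → (Fin p ⊎ Subset p → Bool) → Subset p
cliqueTrace S = tabulate (S ∘ inj₁)

module _ {p k : ℕ} where

  x-vertex∈ : (A : Subset p) → ∣ A ∣ ≡ k → inj₂ A ∈ˡ vertices (Gpk p k)
  x-vertex∈ A ∣A∣≡k =
    ∈-++⁺ʳ (map inj₁ (allFin p)) (∈-map⁺ inj₂ (∈-filter⁺ (λ B → ∣ B ∣ ≟ⁿ k) (∈-allSubsets A) ∣A∣≡k))

  countNbrIn-x : (S : Vtx (Gpk p k) → Bool) (A : Subset p) →
                 countNbrIn (Gpk p k) S (inj₂ A) ≡ ∣ A ∩ cliqueTrace S ∣
  countNbrIn-x S A = begin
      length (filter P? (map inj₁ (allFin p) ++ map inj₂ (kSubsets p k)))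
    ≡⟨ cong length (filter-++ P? (map inj₁ (allFin p)) (map inj₂ (kSubsets p k))) ⟩
      length (filter P? (map inj₁ (allFin p)) ++ filter P? (map inj₂ (kSubsets p k)))
    ≡⟨ cong (λ ys → length (filter P? (map inj₁ (allFin p)) ++ ys)) x-vertices-independent ⟩
      length (filter P? (map inj₁ (allFin p)) ++ [])
    ≡⟨ cong length (++-identityʳ (filter P? (map inj₁ (allFin p)))) ⟩
      length (filter P? (map inj₁ (allFin p)))
    ≡⟨ cong (length ∘ filter P?) (map-tabulate id inj₁) ⟩
      length (filter P? (List.tabulate inj₁))
    ≡⟨ length-filter-tabulate (adjS (inj₂ A)) inj₁ ⟩
      ∣ tabulate (λ u → ⌊ u ∈? A ⌋ ∧ S (inj₁ u)) ∣
    ≡⟨ cong ∣_∣ (tabulate-cong (λ u → cong (_∧ S (inj₁ u)) (⌊∈?⌋≡lookup u A))) ⟩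
      ∣ tabulate (λ u → lookup A u ∧ S (inj₁ u)) ∣
    ≡⟨ cong ∣_∣ (tabulate-lookup-∧ A (S ∘ inj₁)) ⟩
      ∣ A ∩ cliqueTrace S ∣ ∎
    where
    open ≡-Reasoning
    adjS : Vtx (Gpk p k) → Vtx (Gpk p k) → Bool
    adjS v u = adj (Gpk p k) v u ∧ S u
    P? : (u : Vtx (Gpk p k)) → Dec (adjS (inj₂ A) u ≡ true)
    P? = λ u → adjS (inj₂ A) u ≟ᵇ true
    x-vertices-independent : filter P? (map inj₂ (kSubsets p k)) ≡ []
    x-vertices-independent = filter-none P? (All.map⁺ (All.universal (λ _ ()) (kSubsets p k)))

  total12-meeting-bounds : {S : Vtx (Gpk p k) → Bool} → IsTotal12Set (Gpk p k) S →
    (a c : ℕ) → a ≤ ∣ cliqueTrace S ∣ → c ≤ ∣ ∁ (cliqueTrace S) ∣ → a + c ≡ k →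
    1 ≤ a × a ≤ 2
  total12-meeting-bounds {S} total a c a≤t c≤t̄ a+c≡k
    with A , ∣A∣≡a+c , ∣A∩T∣≡a ← ∃-subset-meeting (cliqueTrace S) a c a≤t c≤t̄
    with total (inj₂ A) (x-vertex∈ A (trans ∣A∣≡a+c a+c≡k))
  ... | bounds rewrite countNbrIn-x S A | ∣A∩T∣≡a = bounds

corollary3p2 : (p k : ℕ) → 3 ≤ k → k + 2 ≤ p → NoTotal12Set (Gpk p k)
corollary3p2 p k 3≤k k+2≤p (S , total) = refute (∣ T ∣ ≤? 2) (≤-total ∣ T ∣ k)
  where
  T : Subset p
  T = cliqueTrace S
  meets : (a c : ℕ) → a ≤ ∣ T ∣ → c ≤ ∣ ∁ T ∣ → a + c ≡ k → 1 ≤ a × a ≤ 2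
  meets = total12-meeting-bounds total
  refute : Dec (∣ T ∣ ≤ 2) → ∣ T ∣ ≤ k ⊎ k ≤ ∣ T ∣ → ⊥
  refute (yes t≤2) _ = 1+n≰n (proj₁ (meets 0 k z≤n k≤∣∁T∣ refl))
    where
    k≤∣∁T∣ : k ≤ ∣ ∁ T ∣
    k≤∣∁T∣ = m+∣p∣≤n⇒m≤∣∁p∣ T (≤-trans (+-monoʳ-≤ k t≤2) k+2≤p)
  refute (no t≰2) (inj₁ t≤k) =
    t≰2 (proj₂ (meets ∣ T ∣ (k ∸ ∣ T ∣) ≤-refl k∸t≤∣∁T∣ (m+[n∸m]≡n t≤k)))
    where
    k∸t≤∣∁T∣ : k ∸ ∣ T ∣ ≤ ∣ ∁ T ∣
    k∸t≤∣∁T∣ = m+∣p∣≤n⇒m≤∣∁p∣ T (≤-trans (≤-reflexive (m∸n+n≡m t≤k)) (≤-trans (m≤m+n k 2) k+2≤p))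
  refute (no _) (inj₂ k≤t) = <⇒≱ 3≤k (proj₂ (meets k 0 k≤t z≤n (+-identityʳ k)))
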